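{- Any type I or type II state operator $\mu$ on a commutative pseudo BCK-algebra $A$ is normal, i.e. ${\rm Ker}(\mu)$ is a normal deductive system of $A$.
   Context: A pseudo BCK-algebra is an algebra $(A,\rightarrow,\rightsquigarrow,1)$ of type $(2,2,0)$ such that for all $x,y,z\in A$: $(x\rightarrow y)\rightsquigarrow[(y\rightarrow z)\rightsquigarrow(x\rightarrow z)]=1$; $(x\rightsquigarrow y)\rightarrow[(y\rightsquigarrow z)\rightarrow(x\rightsquigarrow z)]=1$; $1\rightarrow x=x$; $1\rightsquigarrow x=x$; $x\rightarrow 1=1$; and if $x\rightarrow y=1$ and $y\rightarrow x=1$ then $x=y$. The order is $x\le y$ iff $x\rightarrow y=1$. $A$ is commutative if $(x\rightarrow y)\rightsquigarrow y=(y\rightarrow x)\rightsquigarrow x$ and $(x\rightsquigarrow y)\rightarrow y=(y\rightsquigarrow x)\rightarrow x$ for all $x,y$. A deductive system is a subset $D$ with $1\in D$ such that $x, x\rightarrow y\in D$ imply $y\in D$; it is normal if $x\rightarrow y\in D$ iff $x\rightsquigarrow y\in D$. For $\mu:A\to A$ consider, for all $x,y\in A$: $(IS_1)$ $x\le y$ implies $\mu(x)\le\mu(y)$; $(IS_2)$ $\mu(x\rightarrow y)=\mu((x\rightarrow y)\rightsquigarrow y)\rightarrow\mu(y)$ and $\mu(x\rightsquigarrow y)=\mu((x\rightsquigarrow y)\rightarrow y)\rightsquigarrow\mu(y)$; $(IS_2')$ $\mu(x\rightarrow y)=\mu((y\rightarrow x)\rightsquigarrow x)\rightarrow\mu(y)$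 and $\mu(x\rightsquigarrow y)=\mu((y\rightsquigarrow x)\rightarrow x)\rightsquigarrow\mu(y)$; $(IS_3)$ $\mu(\mu(x)\rightarrow\mu(y))=\mu(x)\rightarrow\mu(y)$ and $\mu(\mu(x)\rightsquigarrow\mu(y))=\mu(x)\rightsquigarrow\mu(y)$. A type I state operator satisfies $(IS_1),(IS_2),(IS_3)$; a type II one satisfies $(IS_1),(IS_2'),(IS_3)$. ${\rm Ker}(\mu)=\{x\in A\mid\mu(x)=1\}$; $\mu$ is normal if ${\rm Ker}(\mu)$ is a normal deductive system. -}

module Defs where

open import Level using (Level; _⊔_; suc)
open import Relation.Binary.PropositionalEquality using (_≡_)
open import Data.Product using (_×_)
open import Data.Sum using (_⊎_)
open import Function.Bundles using (_⇔_)

record PseudoBCK (a : Level) : Set (suc a) where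
  infixr 5 _⇒_ _⇝_
  field
    Carrier : Set a
    _⇒_ : Carrier → Carrier → Carrier
    _⇝_ : Carrier → Carrier → Carrier
    one : Carrier
    ax1 : ∀ x y z → (x ⇒ y) ⇝ ((y ⇒ z) ⇝ (x ⇒ z)) ≡ one
    ax2 : ∀ x y z → (x ⇝ y) ⇒ ((y ⇝ z) ⇒ (x ⇝ z)) ≡ one
    ax3 : ∀ x → one ⇒ x ≡ x
    ax4 : ∀ x → one ⇝ x ≡ x
    ax5 : ∀ x → x ⇒ one ≡ one
    ax6 : ∀ x y → x ⇒ y ≡ one → y ⇒ x ≡ one → x ≡ y

  _≤_ : Carrier → Carrier → Set a
  x ≤ y = x ⇒ y ≡ one

module _ {a : Level} (A : PseudoBCK a) where
  open PseudoBCK A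

  IsCommutative : Set a
  IsCommutative = ∀ x y → ((x ⇒ y) ⇝ y ≡ (y ⇒ x) ⇝ x) × ((x ⇝ y) ⇒ y ≡ (y ⇝ x) ⇒ x)

  record IsDeductiveSystem {ℓ : Level} (D : Carrier → Set ℓ) : Set (a ⊔ ℓ) where
    field
      one∈ : D one
      mp : ∀ x y → D x → D (x ⇒ y) → D y

  record IsNormalDS {ℓ : Level} (D : Carrier → Set ℓ) : Set (a ⊔ ℓ) where
    field
      isDS : IsDeductiveSystem D
      normal : ∀ x y → D (x ⇒ y) ⇔ D (x ⇝ y)

  IS1 : (Carrier → Carrier) → Set a
  IS1 μ = ∀ x y → x ≤ y → μ x ≤ μ y

  IS2 : (Carrier → Carrier) → Set a
  IS2 μ = ∀ x y → (μ (x ⇒ y) ≡ μ ((x ⇒ y) ⇝ y) ⇒ μ y)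
                × (μ (x ⇝ y) ≡ μ ((x ⇝ y) ⇒ y) ⇝ μ y)

  IS2′ : (Carrier → Carrier) → Set a
  IS2′ μ = ∀ x y → (μ (x ⇒ y) ≡ μ ((y ⇒ x) ⇝ x) ⇒ μ y)
                 × (μ (x ⇝ y) ≡ μ ((y ⇝ x) ⇒ x) ⇝ μ y)

  IS3 : (Carrier → Carrier) → Set a
  IS3 μ = ∀ x y → (μ (μ x ⇒ μ y) ≡ μ x ⇒ μ y) × (μ (μ x ⇝ μ y) ≡ μ x ⇝ μ y)

  IsTypeIStateOp : (Carrier → Carrier) → Set a
  IsTypeIStateOp μ = IS1 μ × IS2 μ × IS3 μ

  IsTypeIIStateOp : (Carrier → Carrier) → Set a
  IsTypeIIStateOp μ = IS1 μ × IS2′ μ × IS3 μ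

  Ker : (Carrier → Carrier) → Carrier → Set a
  Ker μ x = μ x ≡ one

  IsNormalStateOp : (Carrier → Carrier) → Set a
  IsNormalStateOp μ = IsNormalDS (Ker μ)

module Submission where

-- The kernel of μ is a deductive system already in any pseudo BCK-algebra: modus ponens
-- transfers along (IS₂) because x ≤ (x → y) ⇝ y.  Normality is where commutativity enters:
-- it makes the two "joins" (x → y) ⇝ y and (x ⇝ y) → y coincide, so the two halves of (IS₂)
-- express μ (x → y) and μ (x ⇝ y) through the same element u, as μ u → μ y and μ u ⇝ μ y,
-- and these are 1 simultaneously.  Under commutativity (IS₂′) is literally (IS₂).

open import Defs
open import Level using (Level)
open import Data.Sum using (_⊎_; inj₁; inj₂)
open import Data.Product using (_,_; proj₁; proj₂)
open import Function.Bundles using (mk⇔)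
open import Relation.Binary.PropositionalEquality
  using (_≡_; sym; trans; cong; subst; module ≡-Reasoning)

module _ {a : Level} (A : PseudoBCK a) where
  open PseudoBCK A
  open ≡-Reasoning

  ⇝-pivot : ∀ x y → x ⇝ ((x ⇒ y) ⇝ y) ≡ one
  ⇝-pivot x y = begin
    x ⇝ ((x ⇒ y) ⇝ y)                  ≡⟨ cong (λ t → t ⇝ ((x ⇒ y) ⇝ y)) (sym (ax3 x)) ⟩
    (one ⇒ x) ⇝ ((x ⇒ y) ⇝ y)          ≡⟨ cong (λ t → (one ⇒ x) ⇝ ((x ⇒ y) ⇝ t)) (sym (ax3 y)) ⟩
    (one ⇒ x) ⇝ ((x ⇒ y) ⇝ (one ⇒ y))  ≡⟨ ax1 one x y ⟩
    one                                 ∎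

  ⇒-pivot : ∀ x y → x ≤ ((x ⇝ y) ⇒ y)
  ⇒-pivot x y = begin
    x ⇒ ((x ⇝ y) ⇒ y)                  ≡⟨ cong (λ t → t ⇒ ((x ⇝ y) ⇒ y)) (sym (ax4 x)) ⟩
    (one ⇝ x) ⇒ ((x ⇝ y) ⇒ y)          ≡⟨ cong (λ t → (one ⇝ x) ⇒ ((x ⇝ y) ⇒ t)) (sym (ax4 y)) ⟩
    (one ⇝ x) ⇒ ((x ⇝ y) ⇒ (one ⇝ y))  ≡⟨ ax2 one x y ⟩
    one                                 ∎

  ≤⇒⇝≡one : ∀ {x y} → x ≤ y → x ⇝ y ≡ one
  ≤⇒⇝≡one {x} {y} x≤y = begin
    x ⇝ y                ≡⟨ cong (x ⇝_) (sym (ax4 y)) ⟩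
    x ⇝ (one ⇝ y)        ≡⟨ cong (λ t → x ⇝ (t ⇝ y)) (sym x≤y) ⟩
    x ⇝ ((x ⇒ y) ⇝ y)    ≡⟨ ⇝-pivot x y ⟩
    one                  ∎

  ⇝≡one⇒≤ : ∀ {x y} → x ⇝ y ≡ one → x ≤ y
  ⇝≡one⇒≤ {x} {y} x⇝y≡one = begin
    x ⇒ y                ≡⟨ cong (x ⇒_) (sym (ax3 y)) ⟩
    x ⇒ (one ⇒ y)        ≡⟨ cong (λ t → x ⇒ (t ⇒ y)) (sym x⇝y≡one) ⟩
    x ⇒ ((x ⇝ y) ⇒ y)    ≡⟨ ⇒-pivot x y ⟩
    one                  ∎

  ≤-refl : ∀ x → x ≤ x
  ≤-refl x = begin
    x ⇒ x                ≡⟨ cong (_⇒ x) (sym (ax4 x)) ⟩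
    (one ⇝ x) ⇒ x        ≡⟨ sym (ax3 _) ⟩
    one ⇒ ((one ⇝ x) ⇒ x) ≡⟨ ⇒-pivot one x ⟩
    one                  ∎

  one≤⇒≡one : ∀ {x} → one ≤ x → x ≡ one
  one≤⇒≡one {x} one≤x = trans (sym (ax3 x)) one≤x

  ⇒-antitoneˡ : ∀ {x y} z → x ≤ y → (y ⇒ z) ≤ (x ⇒ z)
  ⇒-antitoneˡ {x} {y} z x≤y = ⇝≡one⇒≤ (begin
    (y ⇒ z) ⇝ (x ⇒ z)                ≡⟨ sym (ax4 _) ⟩
    one ⇝ ((y ⇒ z) ⇝ (x ⇒ z))        ≡⟨ cong (λ t → t ⇝ ((y ⇒ z) ⇝ (x ⇒ z))) (sym x≤y) ⟩
    (x ⇒ y) ⇝ ((y ⇒ z) ⇝ (x ⇒ z))    ≡⟨ ax1 x y z ⟩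
    one                              ∎)

  ⇝-antitoneˡ : ∀ {x y} z → x ⇝ y ≡ one → (y ⇝ z) ⇝ (x ⇝ z) ≡ one
  ⇝-antitoneˡ {x} {y} z x⇝y≡one = ≤⇒⇝≡one (begin
    (y ⇝ z) ⇒ (x ⇝ z)                ≡⟨ sym (ax3 _) ⟩
    one ⇒ ((y ⇝ z) ⇒ (x ⇝ z))        ≡⟨ cong (λ t → t ⇒ ((y ⇝ z) ⇒ (x ⇝ z))) (sym x⇝y≡one) ⟩
    (x ⇝ y) ⇒ ((y ⇝ z) ⇒ (x ⇝ z))    ≡⟨ ax2 x y z ⟩
    one                              ∎)

  ⇒⇝-monoˡ : ∀ {x v} y → x ≤ v → ((x ⇒ y) ⇝ y) ≤ ((v ⇒ y) ⇝ y)
  ⇒⇝-monoˡ y x≤v = ⇝≡one⇒≤ (⇝-antitoneˡ y (≤⇒⇝≡one (⇒-antitoneˡ y x≤v)))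

  ⇝⇒-monoˡ : ∀ {x u} y → x ⇝ u ≡ one → ((x ⇝ y) ⇒ y) ≤ ((u ⇝ y) ⇒ y)
  ⇝⇒-monoˡ y x⇝u≡one = ⇒-antitoneˡ y (⇝≡one⇒≤ (⇝-antitoneˡ y x⇝u≡one))

  module _ (comm : IsCommutative A) where

    ⇒⇝-absorb : ∀ {y v} → y ≤ v → (v ⇒ y) ⇝ y ≡ v
    ⇒⇝-absorb {y} {v} y≤v = begin
      (v ⇒ y) ⇝ y    ≡⟨ proj₁ (comm v y) ⟩
      (y ⇒ v) ⇝ v    ≡⟨ cong (_⇝ v) y≤v ⟩
      one ⇝ v        ≡⟨ ax4 v ⟩
      v              ∎

    ⇝⇒-absorb : ∀ {y u} → y ⇝ u ≡ one → (u ⇝ y) ⇒ y ≡ u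
    ⇝⇒-absorb {y} {u} y⇝u≡one = begin
      (u ⇝ y) ⇒ y    ≡⟨ proj₂ (comm u y) ⟩
      (y ⇝ u) ⇒ u    ≡⟨ cong (_⇒ u) y⇝u≡one ⟩
      one ⇒ u        ≡⟨ ax3 u ⟩
      u              ∎

    -- Both sides are the least upper bound of x and y; each is shown to lie below the other
    -- by applying the monotone map to x ≤ (upper bound) and absorbing.
    ⇒⇝≡⇝⇒ : ∀ x y → (x ⇒ y) ⇝ y ≡ (x ⇝ y) ⇒ y
    ⇒⇝≡⇝⇒ x y = ax6 _ _ u≤v v≤u
      where
      u = (x ⇒ y) ⇝ y
      v = (x ⇝ y) ⇒ y

      u≤v : u ≤ v
      u≤v = subst (λ t → u ≤ t) (⇒⇝-absorb y≤v) (⇒⇝-monoˡ y (⇒-pivot x y))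
        where
        y≤v : y ≤ v
        y≤v = subst (y ≤_) (sym (proj₂ (comm x y))) (⇒-pivot y x)

      v≤u : v ≤ u
      v≤u = subst (λ t → v ≤ t) (⇝⇒-absorb y⇝u≡one) (⇝⇒-monoˡ y (⇝-pivot x y))
        where
        y⇝u≡one : y ⇝ u ≡ one
        y⇝u≡one = subst (λ t → y ⇝ t ≡ one) (sym (proj₁ (comm x y))) (⇝-pivot y x)

    IS2′⇒IS2 : ∀ μ → IS2′ A μ → IS2 A μ
    IS2′⇒IS2 μ is2′ x y =
        trans (proj₁ (is2′ x y)) (cong (λ t → μ t ⇒ μ y) (sym (proj₁ (comm x y))))
      , trans (proj₂ (is2′ x y)) (cong (λ t → μ t ⇝ μ y) (sym (proj₂ (comm x y))))

  module _ (μ : Carrier → Carrier) (is1 : IS1 A μ) (is2 : IS2 A μ) where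

    μ-one : μ one ≡ one
    μ-one = begin
      μ one                         ≡⟨ cong μ (sym (ax5 one)) ⟩
      μ (one ⇒ one)                 ≡⟨ proj₁ (is2 one one) ⟩
      μ ((one ⇒ one) ⇝ one) ⇒ μ one ≡⟨ cong (λ t → μ (t ⇝ one) ⇒ μ one) (ax5 one) ⟩
      μ (one ⇝ one) ⇒ μ one         ≡⟨ cong (λ t → μ t ⇒ μ one) (ax4 one) ⟩
      μ one ⇒ μ one                 ≡⟨ ≤-refl (μ one) ⟩
      one                           ∎

    Ker-mp : ∀ x y → Ker A μ x → Ker A μ (x ⇒ y) → Ker A μ y
    Ker-mp x y μx≡one μ[x⇒y]≡one = begin
      μ y                        ≡⟨ sym (ax3 (μ y)) ⟩
      one ⇒ μ y                  ≡⟨ cong (_⇒ μ y) (sym μu≡one) ⟩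
      μ ((x ⇒ y) ⇝ y) ⇒ μ y      ≡⟨ sym (proj₁ (is2 x y)) ⟩
      μ (x ⇒ y)                  ≡⟨ μ[x⇒y]≡one ⟩
      one                        ∎
      where
      μu≡one : μ ((x ⇒ y) ⇝ y) ≡ one
      μu≡one = one≤⇒≡one
        (subst (_≤ μ ((x ⇒ y) ⇝ y)) μx≡one (is1 _ _ (⇝≡one⇒≤ (⇝-pivot x y))))

    Ker-isDeductiveSystem : IsDeductiveSystem A (Ker A μ)
    Ker-isDeductiveSystem = record { one∈ = μ-one ; mp = Ker-mp }

    module _ (comm : IsCommutative A) where

      Ker-⇒→⇝ : ∀ x y → Ker A μ (x ⇒ y) → Ker A μ (x ⇝ y)
      Ker-⇒→⇝ x y μ[x⇒y]≡one = begin
        μ (x ⇝ y)                ≡⟨ proj₂ (is2 x y) ⟩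
        μ ((x ⇝ y) ⇒ y) ⇝ μ y    ≡⟨ cong (λ t → μ t ⇝ μ y) (sym (⇒⇝≡⇝⇒ comm x y)) ⟩
        μ ((x ⇒ y) ⇝ y) ⇝ μ y    ≡⟨ ≤⇒⇝≡one (trans (sym (proj₁ (is2 x y))) μ[x⇒y]≡one) ⟩
        one                      ∎

      Ker-⇝→⇒ : ∀ x y → Ker A μ (x ⇝ y) → Ker A μ (x ⇒ y)
      Ker-⇝→⇒ x y μ[x⇝y]≡one = begin
        μ (x ⇒ y)                ≡⟨ proj₁ (is2 x y) ⟩
        μ ((x ⇒ y) ⇝ y) ⇒ μ y    ≡⟨ cong (λ t → μ t ⇒ μ y) (⇒⇝≡⇝⇒ comm x y) ⟩
        μ ((x ⇝ y) ⇒ y) ⇒ μ y    ≡⟨ ⇝≡one⇒≤ (trans (sym (proj₂ (is2 x y))) μ[x⇝y]≡one) ⟩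
        one                      ∎

      Ker-isNormalDS : IsNormalStateOp A μ
      Ker-isNormalDS = record
        { isDS   = Ker-isDeductiveSystem
        ; normal = λ x y → mk⇔ (Ker-⇒→⇝ x y) (Ker-⇝→⇒ x y)
        }

proposition5p9 : {a : Level} (A : PseudoBCK a) → IsCommutative A →
    (μ : PseudoBCK.Carrier A → PseudoBCK.Carrier A) →
    (IsTypeIStateOp A μ ⊎ IsTypeIIStateOp A μ) →
    IsNormalStateOp A μ
proposition5p9 A comm μ (inj₁ (is1 , is2 , _))  = Ker-isNormalDS A μ is1 is2 comm
proposition5p9 A comm μ (inj₂ (is1 , is2′ , _)) = Ker-isNormalDS A μ is1 (IS2′⇒IS2 A comm μ is2′) comm
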